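{- (Soundness.) For every sequent $\phi\vdash\psi$ derivable in $L_{LEA}$ and every effect groupoid $\mathbf R$, one has $s_\phi\leq t_\psi$ for all assignments of elements of $R$ to the propositional variables, where $s_\phi,t_\psi$ are the term functions on $\mathbf R$ corresponding to $\phi,\psi$ (interpreting $\cdot$ as $\cdot$, $\neg$ as $'$, $\bot$ as $0$, $\top$ as $1$) and $\leq$ is the induced order of the lattice effect algebra $\mathbb E(\mathbf R)$.
   Context: Formulas: $\phi::=p\mid\phi\cdot\phi\mid\neg\phi\mid\bot\mid\top$ over propositional variables $p$. An axiom written $\phi\dashv\vdash\psi$ means both $\phi\vdash\psi$ and $\psi\vdash\phi$ are axioms (likewise for rule conclusions). The calculus $L_{LEA}$ has, for all formulas $\phi,\psi,\mu,\theta$: ($\neg$-r) from $\phi\vdash\neg\psi$ infer $\psi\vdash\neg\phi$; (itm1) from $\phi\vdash\psi$ and $\psi\vdash\phi$ infer $\phi\cdot\mu\vdash\psi\cdot\mu$; (itm2) from $\phi\vdash\psi$ and $\psi\vdash\phi$ infer $\mu\cdot\phi\vdash\mu\cdot\psi$; (DN) $\neg\neg\phi\dashv\vdash\phi$; (m-$\bot$) from $\phi\cdot\neg\psi\vdash\bot$ infer $\phi\vdash\psi$; ($\bot$-m) from $\phi\vdash\psi$ infer $\phi\cdot\neg\psi\vdash\bot$; (1-l) $\top\cdot\phi\dashv\vdash\phi$; (1-r) $\phi\cdot\top\dashv\vdash\phi$; (0-l) $\bot\cdot\phi\dashv\vdash\bot$; (0-r) $\phi\cdot\bot\dashv\vdash\bot$;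 (ol) $\bot\dashv\vdash\phi\cdot(\psi\cdot\neg\phi)$; (or) $\bot\dashv\vdash(\psi\cdot\neg\phi)\cdot\phi$; (cm) $\phi\cdot\neg(\neg\psi\cdot\phi)\dashv\vdash\neg(\neg\psi\cdot\phi)\cdot\phi$; (mc) $\neg(\neg\psi\cdot\phi)\cdot\phi\dashv\vdash\neg(\neg\phi\cdot\psi)\cdot\psi$; (ocm) $\phi\cdot\psi\dashv\vdash\psi\cdot\neg(\neg(\neg\psi\cdot\neg\phi)\cdot\neg\phi)$; (mds) $\chi(\phi,\psi)\cdot\mu\dashv\vdash\chi(\phi\cdot\mu,\psi\cdot\mu)$ with $\chi(\phi,\psi):=\neg(\neg(\phi\cdot\neg\psi)\cdot\neg\psi)$; (cut) from $\phi\vdash\psi$ and $\psi\vdash\theta$ infer $\phi\vdash\theta$; (ass1) from $\neg\phi\vdash\psi$ and $\neg(\phi\cdot\psi)\vdash\mu$ infer $\neg\psi\vdash\mu$; (ass2) from the same premises infer $\neg\phi\vdash\psi\cdot\mu$; (ass3) from the same premises infer $(\phi\cdot\psi)\cdot\mu\dashv\vdash\phi\cdot(\psi\cdot\mu)$. An effect groupoid is an algebra $(R;\cdot,',0,1)$ of type $(2,1,0,0)$ such that for all $x,y,z$: (NG0) $1$ is a two-sided unit; (NG1) $x=x''$; (NG2) $x\cdot0=0\cdot x=0$; (NG3) $0'=1$; (NG4) $x\cdot(y\cdot x')=0=(y\cdot x')\cdot x$; (NG5) $x\cdot y=y\cdot[(y'\cdot x')'\cdot x']'$; (NG6) $x\cdot(y'\cdot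 x)'=(y'\cdot x)'\cdot x=(x'\cdot y)'\cdot y$; (NG7) $[(x\cdot y')'\cdot y']'\cdot z=[((x\cdot z)\cdot(y\cdot z)')'\cdot(y\cdot z)']'$; (NG8) if $x'\cdot y'=0$ and $(x\cdot y)'\cdot z'=0$ then $y'\cdot z'=0$, $x'\cdot(y\cdot z)'=0$ and $(x\cdot y)\cdot z=x\cdot(y\cdot z)$. $\mathbb E(\mathbf R)=(R;\oplus,',0,1)$ with $x\oplus y:=(x'\cdot y')'$ defined iff $x\cdot y=0$; it is an effect algebra, and its induced order is $a\leq b$ iff $a\oplus c=b$ for some $c$. -}

module Defs where

open import Level using (Level; suc)
open import Data.Nat using (ℕ)
open import Data.Product using (Σ; _×_)
open import Relation.Binary.PropositionalEquality using (_≡_)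

record EffectGroupoid (a : Level) : Set (suc a) where
  infixl 7 _·_
  field
    Carrier : Set a
    _·_     : Carrier → Carrier → Carrier
    _′      : Carrier → Carrier
    𝟘 𝟙     : Carrier
    NG0-l : ∀ x → 𝟙 · x ≡ x
    NG0-r : ∀ x → x · 𝟙 ≡ x
    NG1   : ∀ x → x ≡ (x ′) ′
    NG2-r : ∀ x → x · 𝟘 ≡ 𝟘
    NG2-l : ∀ x → 𝟘 · x ≡ 𝟘
    NG3   : 𝟘 ′ ≡ 𝟙
    NG4-l : ∀ x y → x · (y · x ′) ≡ 𝟘
    NG4-r : ∀ x y → (y · x ′) · x ≡ 𝟘
    NG5   : ∀ x y → x · y ≡ y · ((((y ′) · (x ′)) ′ · (x ′)) ′)
    NG6-1 : ∀ x y → x · ((y ′ · x) ′) ≡ (y ′ · x) ′ · x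
    NG6-2 : ∀ x y → (y ′ · x) ′ · x ≡ (x ′ · y) ′ · y
    NG7   : ∀ x y z → (((x · y ′) ′ · y ′) ′) · z
                      ≡ ((((x · z) · ((y · z) ′)) ′ · ((y · z) ′)) ′)
    NG8   : ∀ x y z → x ′ · y ′ ≡ 𝟘 → (x · y) ′ · z ′ ≡ 𝟘 →
              (y ′ · z ′ ≡ 𝟘) × (x ′ · (y · z) ′ ≡ 𝟘) × ((x · y) · z ≡ x · (y · z))

  -- partial operation of E(R): x ⊕ y := (x'·y')', defined iff x·y = 0
  -- induced order: a ≤ b iff a ⊕ c = b for some c
  _≤E_ : Carrier → Carrier → Set a
  a ≤E b = Σ Carrier (λ c → (a · c ≡ 𝟘) × ((a ′ · c ′) ′ ≡ b))

infixl 7 _∙_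
data Fm : Set where
  var : ℕ → Fm
  _∙_ : Fm → Fm → Fm
  ¬_  : Fm → Fm
  ⊥f  : Fm
  ⊤f  : Fm

χ : Fm → Fm → Fm
χ φ ψ = ¬ (¬ (φ ∙ ¬ ψ) ∙ ¬ ψ)

infix 4 _⊢_
data _⊢_ : Fm → Fm → Set where
  ¬-r   : ∀ {φ ψ} → φ ⊢ ¬ ψ → ψ ⊢ ¬ φ
  itm1  : ∀ {φ ψ μ} → φ ⊢ ψ → ψ ⊢ φ → φ ∙ μ ⊢ ψ ∙ μ
  itm2  : ∀ {φ ψ μ} → φ ⊢ ψ → ψ ⊢ φ → μ ∙ φ ⊢ μ ∙ ψ
  DN₁   : ∀ {φ} → ¬ ¬ φ ⊢ φ
  DN₂   : ∀ {φ} → φ ⊢ ¬ ¬ φ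
  m-⊥   : ∀ {φ ψ} → φ ∙ ¬ ψ ⊢ ⊥f → φ ⊢ ψ
  ⊥-m   : ∀ {φ ψ} → φ ⊢ ψ → φ ∙ ¬ ψ ⊢ ⊥f
  1-l₁  : ∀ {φ} → ⊤f ∙ φ ⊢ φ
  1-l₂  : ∀ {φ} → φ ⊢ ⊤f ∙ φ
  1-r₁  : ∀ {φ} → φ ∙ ⊤f ⊢ φ
  1-r₂  : ∀ {φ} → φ ⊢ φ ∙ ⊤f
  0-l₁  : ∀ {φ} → ⊥f ∙ φ ⊢ ⊥f
  0-l₂  : ∀ {φ} → ⊥f ⊢ ⊥f ∙ φ
  0-r₁  : ∀ {φ} → φ ∙ ⊥f ⊢ ⊥f
  0-r₂  : ∀ {φ} → ⊥f ⊢ φ ∙ ⊥f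
  ol₁   : ∀ {φ ψ} → ⊥f ⊢ φ ∙ (ψ ∙ ¬ φ)
  ol₂   : ∀ {φ ψ} → φ ∙ (ψ ∙ ¬ φ) ⊢ ⊥f
  or₁   : ∀ {φ ψ} → ⊥f ⊢ (ψ ∙ ¬ φ) ∙ φ
  or₂   : ∀ {φ ψ} → (ψ ∙ ¬ φ) ∙ φ ⊢ ⊥f
  cm₁   : ∀ {φ ψ} → φ ∙ ¬ (¬ ψ ∙ φ) ⊢ ¬ (¬ ψ ∙ φ) ∙ φ
  cm₂   : ∀ {φ ψ} → ¬ (¬ ψ ∙ φ) ∙ φ ⊢ φ ∙ ¬ (¬ ψ ∙ φ)
  mc₁   : ∀ {φ ψ} → ¬ (¬ ψ ∙ φ) ∙ φ ⊢ ¬ (¬ φ ∙ ψ) ∙ ψ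
  mc₂   : ∀ {φ ψ} → ¬ (¬ φ ∙ ψ) ∙ ψ ⊢ ¬ (¬ ψ ∙ φ) ∙ φ
  ocm₁  : ∀ {φ ψ} → φ ∙ ψ ⊢ ψ ∙ ¬ (¬ (¬ ψ ∙ ¬ φ) ∙ ¬ φ)
  ocm₂  : ∀ {φ ψ} → ψ ∙ ¬ (¬ (¬ ψ ∙ ¬ φ) ∙ ¬ φ) ⊢ φ ∙ ψ
  mds₁  : ∀ {φ ψ μ} → χ φ ψ ∙ μ ⊢ χ (φ ∙ μ) (ψ ∙ μ)
  mds₂  : ∀ {φ ψ μ} → χ (φ ∙ μ) (ψ ∙ μ) ⊢ χ φ ψ ∙ μ
  cut   : ∀ {φ ψ θ} → φ ⊢ ψ → ψ ⊢ θ → φ ⊢ θ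
  ass1  : ∀ {φ ψ μ} → ¬ φ ⊢ ψ → ¬ (φ ∙ ψ) ⊢ μ → ¬ ψ ⊢ μ
  ass2  : ∀ {φ ψ μ} → ¬ φ ⊢ ψ → ¬ (φ ∙ ψ) ⊢ μ → ¬ φ ⊢ ψ ∙ μ
  ass3₁ : ∀ {φ ψ μ} → ¬ φ ⊢ ψ → ¬ (φ ∙ ψ) ⊢ μ → (φ ∙ ψ) ∙ μ ⊢ φ ∙ (ψ ∙ μ)
  ass3₂ : ∀ {φ ψ μ} → ¬ φ ⊢ ψ → ¬ (φ ∙ ψ) ⊢ μ → φ ∙ (ψ ∙ μ) ⊢ (φ ∙ ψ) ∙ μ

module _ {a} (R : EffectGroupoid a) where
  open EffectGroupoid R
  ⟦_⟧ : Fm → (ℕ → Carrier) → Carrier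
  ⟦ var n ⟧ ρ = ρ n
  ⟦ φ ∙ ψ ⟧ ρ = ⟦ φ ⟧ ρ · ⟦ ψ ⟧ ρ
  ⟦ ¬ φ ⟧ ρ = (⟦ φ ⟧ ρ) ′
  ⟦ ⊥f ⟧ ρ = 𝟘
  ⟦ ⊤f ⟧ ρ = 𝟙

-- Inside an effect groupoid R the order of the effect algebra E(R) has an
-- equational description: x ≤ y holds iff x is orthogonal to y′, i.e.
-- x · y′ = 0 (then y = x ⊕ (y · x′)).  The proof works with this order
-- x ⊑ y := x · y′ ≡ 𝟘, which is much easier to handle than ≤E.
--
-- Next,
-- soundness for ⊑ is proved by induction on derivations: each axiom of
-- L_LEA is an equation of R (so holds for ⊑ by reflexivity) or has 𝟘 on
-- its left, and each rule is an instance of one of the order lemmas or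
-- of NG8.
module Submission where

open import Defs
open import Level using (Level)
open import Data.Nat using (ℕ)
open import Data.Product using (_,_; proj₁; proj₂)
open import Relation.Binary.PropositionalEquality

module EffectGroupoidOrder {a : Level} (R : EffectGroupoid a) where
  open EffectGroupoid R
  open ≡-Reasoning

  infix 4 _⊑_
  _⊑_ : Carrier → Carrier → Set a
  x ⊑ y = x · y ′ ≡ 𝟘

  ′′-elim : ∀ x → x ′ ′ ≡ x
  ′′-elim x = sym (NG1 x)

  ′-injective : ∀ {x y} → x ′ ≡ y ′ → x ≡ y
  ′-injective {x} {y} e = trans (NG1 x) (trans (cong _′ e) (′′-elim y))

  𝟘′-unitˡ : ∀ x → 𝟘 ′ · x ≡ x
  𝟘′-unitˡ x = trans (cong (_· x) NG3) (NG0-l x)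

  𝟘′-unitʳ : ∀ x → x · 𝟘 ′ ≡ x
  𝟘′-unitʳ x = trans (cong (x ·_) NG3) (NG0-r x)

  NG6-1′ : ∀ x y → x · (y · x) ′ ≡ (y · x) ′ · x
  NG6-1′ x y = subst (λ t → x · (t · x) ′ ≡ (t · x) ′ · x) (′′-elim y) (NG6-1 x (y ′))

  NG6-2′ : ∀ x y → (x · y) ′ · y ≡ (y ′ · x ′) ′ · x ′
  NG6-2′ x y = subst (λ t → (t · y) ′ · y ≡ (y ′ · x ′) ′ · x ′) (′′-elim x) (NG6-2 y (x ′))

  -- Orthogonality x · y = 0 is symmetric: y is then (y′·x′)′·x′, killed by x (NG4).
  ⊥-sym : ∀ {x y} → x · y ≡ 𝟘 → y · x ≡ 𝟘
  ⊥-sym {x} {y} h = begin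
    y · x                        ≡⟨ cong (_· x) y-decomposed ⟩
    ((y ′ · x ′) ′ · x ′) · x    ≡⟨ NG4-r x ((y ′ · x ′) ′) ⟩
    𝟘                            ∎
    where
    y-decomposed : y ≡ (y ′ · x ′) ′ · x ′
    y-decomposed = begin
      y                      ≡⟨ sym (𝟘′-unitˡ y) ⟩
      𝟘 ′ · y                ≡⟨ cong (λ t → t ′ · y) (sym h) ⟩
      (x · y) ′ · y          ≡⟨ NG6-2′ x y ⟩
      (y ′ · x ′) ′ · x ′    ∎

  ⊥-commute : ∀ {x c} → c · x ≡ 𝟘 → x ′ · c ′ ≡ c ′ · x ′
  ⊥-commute {x} {c} h = begin
    x ′ · c ′                                  ≡⟨ NG5 (x ′) (c ′) ⟩
    c ′ · ((c ′ ′ · x ′ ′) ′ · x ′ ′) ′        ≡⟨ cong₂ (λ s t → c ′ · ((s · t) ′ · t) ′) (′′-elim c) (′′-elim x) ⟩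
    c ′ · ((c · x) ′ · x) ′                    ≡⟨ cong (λ t → c ′ · (t ′ · x) ′) h ⟩
    c ′ · (𝟘 ′ · x) ′                          ≡⟨ cong (λ t → c ′ · t ′) (𝟘′-unitˡ x) ⟩
    c ′ · x ′                                  ∎

  ⊑-absorb : ∀ {x y} → x ⊑ y → (x · y ′) ′ · y ′ ≡ y ′
  ⊑-absorb {x} {y} h = trans (cong (λ t → t ′ · y ′) h) (𝟘′-unitˡ (y ′))

  ⊑-absorb-dual : ∀ {x y} → x ⊑ y → (y · x ′) ′ · x ′ ≡ y ′
  ⊑-absorb-dual {x} {y} h = begin
    (y · x ′) ′ · x ′          ≡⟨ NG6-2′ y (x ′) ⟩
    (x ′ ′ · y ′) ′ · y ′      ≡⟨ cong (λ t → (t · y ′) ′ · y ′) (′′-elim x) ⟩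
    (x · y ′) ′ · y ′          ≡⟨ ⊑-absorb h ⟩
    y ′                        ∎

  -- If x ⊑ y then y = x ⊕ (y · x′), the witness for x ≤E y.
  ⊑-decompose : ∀ {x y} → x ⊑ y → (x ′ · (y · x ′) ′) ′ ≡ y
  ⊑-decompose {x} {y} h = begin
    (x ′ · (y · x ′) ′) ′      ≡⟨ cong _′ (NG6-1′ (x ′) y) ⟩
    ((y · x ′) ′ · x ′) ′      ≡⟨ cong _′ (⊑-absorb-dual h) ⟩
    y ′ ′                      ≡⟨ ′′-elim y ⟩
    y                          ∎

  ⊑⇒≤E : ∀ {x y} → x ⊑ y → x ≤E y
  ⊑⇒≤E {x} {y} h = y · x ′ , NG4-l x y , ⊑-decompose h

  ⊑-refl : ∀ x → x ⊑ x
  ⊑-refl x = trans (cong (x ·_) (sym (NG0-l (x ′)))) (NG4-l x 𝟙)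

  ≡⇒⊑ : ∀ {x y} → x ≡ y → x ⊑ y
  ≡⇒⊑ {x} refl = ⊑-refl x

  𝟘-least : ∀ x → 𝟘 ⊑ x
  𝟘-least x = NG2-l (x ′)

  -- Both complements equal (y·x′)′·x′, by the two absorption laws.
  ⊑-antisym : ∀ {x y} → x ⊑ y → y ⊑ x → x ≡ y
  ⊑-antisym h₁ h₂ = ′-injective (trans (sym (⊑-absorb h₂)) (⊑-absorb-dual h₁))

  -- Write y = (c′ · x′)′ with c = y·x′ orthogonal to x; then NG8 applied
  -- to c′, x′, z turns (c′·x′)′ ⊑ z into x ⊑ z.
  ⊑-trans : ∀ {x y z} → x ⊑ y → y ⊑ z → x ⊑ z
  ⊑-trans {x} {y} {z} h₁ h₂ = subst (λ t → t · z ′ ≡ 𝟘) (′′-elim x) (proj₁ (NG8 (c ′) (x ′) z c⊥x c′x′⊑z))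
    where
    c = y · x ′
    c·x≡𝟘 : c · x ≡ 𝟘
    c·x≡𝟘 = ⊥-sym (NG4-l x y)
    c⊥x : c ′ ′ · x ′ ′ ≡ 𝟘
    c⊥x = trans (cong₂ _·_ (′′-elim c) (′′-elim x)) c·x≡𝟘
    y≡c′x′ : (c ′ · x ′) ′ ≡ y
    y≡c′x′ = trans (cong _′ (sym (⊥-commute c·x≡𝟘))) (⊑-decompose h₁)
    c′x′⊑z : (c ′ · x ′) ′ · z ′ ≡ 𝟘
    c′x′⊑z = trans (cong (_· z ′) y≡c′x′) h₂

  ⊑-contra : ∀ {x y} → x ⊑ y ′ → y ⊑ x ′
  ⊑-contra {x} {y} h = subst (λ t → y · t ≡ 𝟘) (NG1 x) (⊥-sym (subst (λ t → x · t ≡ 𝟘) (′′-elim y) h))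

  ⊑𝟘⇒≡𝟘 : ∀ {x} → x ⊑ 𝟘 → x ≡ 𝟘
  ⊑𝟘⇒≡𝟘 {x} h = trans (sym (𝟘′-unitʳ x)) h

  ≡𝟘⇒⊑𝟘 : ∀ {x} → x ≡ 𝟘 → x ⊑ 𝟘
  ≡𝟘⇒⊑𝟘 {x} h = trans (𝟘′-unitʳ x) h

  sound : ∀ {φ ψ} → φ ⊢ ψ → (ρ : ℕ → Carrier) → ⟦ R ⟧ φ ρ ⊑ ⟦ R ⟧ ψ ρ
  sound (¬-r h) ρ = ⊑-contra (sound h ρ)
  sound (itm1 {μ = μ} h₁ h₂) ρ = ≡⇒⊑ (cong (_· ⟦ R ⟧ μ ρ) (⊑-antisym (sound h₁ ρ) (sound h₂ ρ)))
  sound (itm2 {μ = μ} h₁ h₂) ρ = ≡⇒⊑ (cong (⟦ R ⟧ μ ρ ·_) (⊑-antisym (sound h₁ ρ) (sound h₂ ρ)))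
  sound DN₁ ρ = ≡⇒⊑ (′′-elim _)
  sound DN₂ ρ = ≡⇒⊑ (NG1 _)
  sound (m-⊥ h) ρ = ⊑𝟘⇒≡𝟘 (sound h ρ)
  sound (⊥-m h) ρ = ≡𝟘⇒⊑𝟘 (sound h ρ)
  sound 1-l₁ ρ = ≡⇒⊑ (NG0-l _)
  sound 1-l₂ ρ = ≡⇒⊑ (sym (NG0-l _))
  sound 1-r₁ ρ = ≡⇒⊑ (NG0-r _)
  sound 1-r₂ ρ = ≡⇒⊑ (sym (NG0-r _))
  sound 0-l₁ ρ = ≡⇒⊑ (NG2-l _)
  sound 0-l₂ ρ = 𝟘-least _
  sound 0-r₁ ρ = ≡⇒⊑ (NG2-r _)
  sound 0-r₂ ρ = 𝟘-least _
  sound ol₁ ρ = 𝟘-least _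
  sound ol₂ ρ = ≡⇒⊑ (NG4-l _ _)
  sound or₁ ρ = 𝟘-least _
  sound or₂ ρ = ≡⇒⊑ (NG4-r _ _)
  sound cm₁ ρ = ≡⇒⊑ (NG6-1 _ _)
  sound cm₂ ρ = ≡⇒⊑ (sym (NG6-1 _ _))
  sound mc₁ ρ = ≡⇒⊑ (NG6-2 _ _)
  sound mc₂ ρ = ≡⇒⊑ (sym (NG6-2 _ _))
  sound ocm₁ ρ = ≡⇒⊑ (NG5 _ _)
  sound ocm₂ ρ = ≡⇒⊑ (sym (NG5 _ _))
  sound mds₁ ρ = ≡⇒⊑ (NG7 _ _ _)
  sound mds₂ ρ = ≡⇒⊑ (sym (NG7 _ _ _))
  sound (cut h₁ h₂) ρ = ⊑-trans (sound h₁ ρ) (sound h₂ ρ)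
  sound (ass1 h₁ h₂) ρ = proj₁ (NG8 _ _ _ (sound h₁ ρ) (sound h₂ ρ))
  sound (ass2 h₁ h₂) ρ = proj₁ (proj₂ (NG8 _ _ _ (sound h₁ ρ) (sound h₂ ρ)))
  sound (ass3₁ h₁ h₂) ρ = ≡⇒⊑ (proj₂ (proj₂ (NG8 _ _ _ (sound h₁ ρ) (sound h₂ ρ))))
  sound (ass3₂ h₁ h₂) ρ = ≡⇒⊑ (sym (proj₂ (proj₂ (NG8 _ _ _ (sound h₁ ρ) (sound h₂ ρ)))))

mainTheorem9 : ∀ {a : Level} {φ ψ : Fm} → φ ⊢ ψ → (R : EffectGroupoid a) → (ρ : ℕ → EffectGroupoid.Carrier R) → EffectGroupoid._≤E_ R (⟦_⟧ R φ ρ) (⟦_⟧ R ψ ρ)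
mainTheorem9 d R ρ = ⊑⇒≤E (sound d ρ)
  where open EffectGroupoidOrder R
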